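{- Let $\overline{n}\in\mathbb{N}_{>0}^t$, $n=\sum_{i=1}^t\overline{n}_i$, $N=\{1,\dots,n\}$, and $N_i=\{\sum_{j=1}^{i-1}\overline{n}_j+1,\dots,\sum_{j=1}^{i}\overline{n}_j\}$ for $1\le i\le t$. Let $m^1,\dots,m^r\in\mathbb{N}^t$ be pairwise incomparable (with respect to $\preceq$) with $\mathbf{0}\preceq m^i\preceq\overline{n}$ for all $1\le i\le r$. Suppose that for all $1\le i,j\le t$ with $i\ne j$ there is an index $1\le h\le r$ such that for $m':=m^h+e^i-e^j$ or for $m':=m^h-e^i+e^j$ we have $\mathbf{0}\preceq m'\preceq\overline{n}$ and there is no index $1\le h'\le r$ with $m^{h'}\succeq m'$. Define $v\colon 2^N\to\{0,1\}$ by $v(S)=1$ iff there is an index $1\le h\le r$ with $m^S\succeq m^h$, where $m^S=(|S\cap N_1|,\dots,|S\cap N_t|)$. Then the simple game $v$ has $N_1,\dots,N_t$ as its equivalence classes of players, and its minimal winning vectors are exactly $m^1,\dots,m^r$.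
   Context: A simple game with player set $N$ is a map $v\colon 2^N\to\{0,1\}$ with $v(\emptyset)=0$, $v(N)=1$ and $v(S)\le v(T)$ for $S\subseteq T$. Players $i,j$ are equivalent if $v(S\cup\{i\})=v(S\cup\{j\})$ for all $S\subseteq N\setminus\{i,j\}$; the equivalence classes of players are the classes of this equivalence relation. With respect to the partition $N_1,\dots,N_t$, a vector $m$ is a minimal winning vector if $m=m^S$ for a minimal winning coalition $S$ (a coalition with $v(S)=1$ all of whose proper subsets are losing). For $x,y\in\mathbb{N}^t$, $x\preceq y$ (equivalently $y\succeq x$) means $x_i\le y_i$ for all $i$; $x,y$ are incomparable if neither $x\preceq y$ nor $y\preceq x$. $e^i$ denotes the $i$-th unit vector of $\mathbb{N}^t$ and $\mathbf{0}$ the zero vector. -}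

module Defs where

open import Data.Nat using (ℕ; zero; suc; _+_; _≤_; _<_; _≤?_; _<?_)
open import Data.Integer using (ℤ; +_; _-_) renaming (_+_ to _+ℤ_; _≤_ to _≤ℤ_)
open import Data.Fin using (Fin; toℕ) renaming (zero to fzero; suc to fsuc; _≟_ to _≟F_)
open import Data.Fin.Subset using (Subset; _∩_; _∪_; ⁅_⁆; ∣_∣; _∈_; _∉_; _⊂_)
open import Data.Vec using (tabulate)
open import Data.Bool using (_∧_; if_then_else_)
open import Data.Product using (∃; _×_)
open import Relation.Nullary using (¬_; does)
open import Function.Bundles using (_⇔_)

sumF : ∀ {t} → (Fin t → ℕ) → ℕ
sumF {zero}  f = 0
sumF {suc t} f = f fzero + sumF (λ i → f (fsuc i))

prefix : ∀ {t} → (Fin t → ℕ) → Fin t → ℕ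
prefix f fzero    = 0
prefix f (fsuc i) = f fzero + prefix (λ j → f (fsuc j)) i

-- Players are Fin n with n = sumF nb (player p corresponds to p+1 in the paper).
-- Block nb i = N_i = { p | prefix nb i ≤ p < prefix nb i + nb i }
Block : ∀ {t} (nb : Fin t → ℕ) → Fin t → Subset (sumF nb)
Block nb i = tabulate (λ p → does (prefix nb i ≤? toℕ p) ∧ does (toℕ p <? prefix nb i + nb i))

mvec : ∀ {t} (nb : Fin t → ℕ) → Subset (sumF nb) → Fin t → ℕ
mvec nb S i = ∣ S ∩ Block nb i ∣

_≼_ : ∀ {t} → (Fin t → ℕ) → (Fin t → ℕ) → Set
x ≼ y = ∀ k → x k ≤ y k

Winning : ∀ {t r} (nb : Fin t → ℕ) → (Fin r → Fin t → ℕ) → Subset (sumF nb) → Set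
Winning nb m S = ∃ λ h → m h ≼ mvec nb S

unit : ∀ {t} → Fin t → Fin t → ℤ
unit i k = if does (i ≟F k) then + 1 else + 0

plusMinus : ∀ {t} → (Fin t → ℕ) → Fin t → Fin t → Fin t → ℤ
plusMinus x i j k = ((+ x k) +ℤ unit i k) - unit j k

minusPlus : ∀ {t} → (Fin t → ℕ) → Fin t → Fin t → Fin t → ℤ
minusPlus x i j k = ((+ x k) - unit i k) +ℤ unit j k

GoodShift : ∀ {t r} (nb : Fin t → ℕ) → (Fin r → Fin t → ℕ) → (Fin t → ℤ) → Set
GoodShift nb m m' =
  (∀ k → + 0 ≤ℤ m' k) × (∀ k → m' k ≤ℤ + nb k) × ¬ (∃ λ h' → ∀ k → m' k ≤ℤ + m h' k)

Equivalent : ∀ {n} → (Subset n → Set) → Fin n → Fin n → Set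
Equivalent W p q = ∀ S → p ∉ S → q ∉ S → (W (S ∪ ⁅ p ⁆) ⇔ W (S ∪ ⁅ q ⁆))

SameBlock : ∀ {t} (nb : Fin t → ℕ) → Fin (sumF nb) → Fin (sumF nb) → Set
SameBlock nb p q = ∃ λ i → p ∈ Block nb i × q ∈ Block nb i

MinimalWinning : ∀ {n} → (Subset n → Set) → Subset n → Set
MinimalWinning W S = W S × (∀ T → T ⊂ S → ¬ W T)

-- A coalition only matters through its class-count vector m^S, and the game is the
-- up-set of ℕᵗ generated by the m^h; players of one class are therefore interchangeable.
-- Coalitions avoiding two given players can realise any count vector that leaves room for
-- them, so if p ∈ N_i and q ∈ N_j (i ≠ j) were equivalent, winning would be invariant under
-- trading a class-j player for a class-i player below n̄. Applied below the minimal winning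
-- vector m^h = c + e^j, this makes c + e^i = m^h + e^i − e^j a minimal winning vector too,
-- hence dominated by some m^{h'}, contradicting the shift hypothesis (the shift
-- m^h − e^i + e^j is the same with p and q swapped). Incomparability makes every m^h
-- minimal among winning vectors, so a coalition realising m^h is minimal winning; and a
-- minimal winning coalition S above m^h equals it, since removing a player from a class
-- where m^S exceeds m^h would leave S winning.

module Submission where

open import Defs
open import Data.Nat using (ℕ; zero; suc; _+_; _∸_; _≤_; _<_; z≤n; s≤s; s≤s⁻¹; _≤?_; _<?_)
open import Data.Nat.Properties
import Data.Integer as ℤ
import Data.Integer.Properties as ℤₚ
open import Data.Fin using (Fin; toℕ) renaming (zero to fzero; suc to fsuc; _≟_ to _≟F_)
open import Data.Fin.Properties using (toℕ<n)
open import Data.Fin.Subset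
open import Data.Fin.Subset.Properties
open import Data.Vec using (_∷_; []; here; there; tabulate)
open import Data.Vec.Properties using (lookup∘tabulate; tabulate-cong; []=⇒lookup; lookup⇒[]=)
open import Data.Bool using (true; false; _∧_; if_then_else_)
open import Data.Product using (∃; _×_; _,_; proj₁; proj₂)
open import Data.Sum using (_⊎_; inj₁; inj₂)
open import Function using (_∘_)
open import Function.Bundles using (_⇔_; mk⇔; Equivalence)
open import Function.Properties.Equivalence using () renaming (sym to ⇔-sym)
import Algebra.Properties.CommutativeSemigroup as CommSemigroup
open import Relation.Nullary using (¬_; Dec; yes; no; does; contradiction)
open import Relation.Nullary.Decidable using (_×-dec_; dec-true; dec-false; does-⇔)
open import Relation.Binary.PropositionalEquality

private
  variable
    n t : ℕ

x∈q⇒x∉p─q : ∀ {x : Fin n} {p q : Subset n} → x ∈ q → x ∉ p ─ q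
x∈q⇒x∉p─q {p = _ ∷ _} here        ()
x∈q⇒x∉p─q {p = _ ∷ _} (there x∈q) (there x∈p─q) = x∈q⇒x∉p─q x∈q x∈p─q

x∉p-x : ∀ {p : Subset n} (x : Fin n) → x ∉ p - x
x∉p-x x = x∈q⇒x∉p─q (x∈⁅x⁆ x)

∪⁅⁆-⊆ : ∀ {p q : Subset n} {x} → p ⊆ q → x ∈ q → p ∪ ⁅ x ⁆ ⊆ q
∪⁅⁆-⊆ {p = p} {x = x} p⊆q x∈q y∈ with x∈p∪q⁻ p ⁅ x ⁆ y∈
... | inj₁ y∈p    = p⊆q y∈p
... | inj₂ y∈⁅x⁆ rewrite x∈⁅y⁆⇒x≡y x y∈⁅x⁆ = x∈q

⊆-[p-x]∪⁅x⁆ : ∀ (p : Subset n) x → p ⊆ (p - x) ∪ ⁅ x ⁆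
⊆-[p-x]∪⁅x⁆ p x {y} y∈p with y ≟F x
... | yes refl = x∈p∪q⁺ (inj₂ (x∈⁅x⁆ x))
... | no y≢x   = x∈p∪q⁺ (inj₁ (x∈p∧x≢y⇒x∈p-y y∈p y≢x))

equivalent-sym : ∀ {W : Subset n → Set} {p q} → Equivalent W p q → Equivalent W q p
equivalent-sym equivalent S q∉S p∉S = ⇔-sym (equivalent S p∉S q∉S)

δ : Fin t → Fin t → ℕ
δ i k = if does (i ≟F k) then 1 else 0

δ-refl : ∀ (i : Fin t) → δ i i ≡ 1
δ-refl i rewrite dec-true (i ≟F i) refl = refl

δ-≢ : ∀ {i k : Fin t} → i ≢ k → δ i k ≡ 0
δ-≢ {i = i} {k} i≢k rewrite dec-false (i ≟F k) i≢k = refl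

_⊕_ : (Fin t → ℕ) → Fin t → Fin t → ℕ
(x ⊕ i) k = x k + δ i k

_⊖_ : (Fin t → ℕ) → Fin t → Fin t → ℕ
(x ⊖ i) k = x k ∸ δ i k

-- Tighter than _≼_, which has the default fixity 20.
infixl 25 _⊕_ _⊖_

≼-refl : ∀ {x : Fin t → ℕ} → x ≼ x
≼-refl k = ≤-refl

≼-reflexive : ∀ {x y : Fin t → ℕ} → x ≗ y → x ≼ y
≼-reflexive x≗y k = ≤-reflexive (x≗y k)

≼-trans : ∀ {x y z : Fin t → ℕ} → x ≼ y → y ≼ z → x ≼ z
≼-trans x≼y y≼z k = ≤-trans (x≼y k) (y≼z k)

≼-⊕ : ∀ {x : Fin t → ℕ} i → x ≼ x ⊕ i
≼-⊕ {x = x} i k = m≤m+n (x k) (δ i k)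

⊕-mono-≼ : ∀ {x y : Fin t → ℕ} i → x ≼ y → x ⊕ i ≼ y ⊕ i
⊕-mono-≼ i x≼y k = +-monoˡ-≤ (δ i k) (x≼y k)

⊕-cancel-≼ : ∀ {x y : Fin t → ℕ} i → x ⊕ i ≼ y ⊕ i → x ≼ y
⊕-cancel-≼ i le k = +-cancelʳ-≤ (δ i k) _ _ (le k)

⊕-diag : ∀ (x : Fin t → ℕ) i → (x ⊕ i) i ≡ suc (x i)
⊕-diag x i = trans (cong (x i +_) (δ-refl i)) (+-comm (x i) 1)

x⊕i⋠x : ∀ (x : Fin t → ℕ) i → ¬ (x ⊕ i ≼ x)
x⊕i⋠x x i le = 1+n≰n (subst (_≤ x i) (⊕-diag x i) (le i))

δ≤ : ∀ {x : Fin t → ℕ} {i} → 1 ≤ x i → ∀ k → δ i k ≤ x k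
δ≤ {i = i} 1≤xi k with i ≟F k
... | yes refl = 1≤xi
... | no _     = z≤n

⊖-⊕ : ∀ {x : Fin t → ℕ} {i} → 1 ≤ x i → x ⊖ i ⊕ i ≗ x
⊖-⊕ {x = x} {i} 1≤xi k = m∸n+n≡m (δ≤ {x = x} {i} 1≤xi k)

⊖-≼ : ∀ {x y : Fin t → ℕ} i → x ≼ y ⊕ i → x ⊖ i ≼ y
⊖-≼ {x = x} {y} i le k = m≤n+o⇒m∸n≤o (x k) (δ i k) (subst (x k ≤_) (+-comm (y k) (δ i k)) (le k))

≼⊕⇒≼ : ∀ {x y : Fin t → ℕ} {i} → x ≼ y ⊕ i → x i ≤ y i → x ≼ y
≼⊕⇒≼ {x = x} {y} {i} le xi≤yi k with i ≟F k | le k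
... | yes refl | _    = xi≤yi
... | no _     | xk≤ = subst (x k ≤_) (+-identityʳ (y k)) xk≤

⊕⊕-≼ : ∀ {x z : Fin t → ℕ} {i j} → i ≢ j → x ⊕ i ≼ z → x ⊕ j ≼ z → x ⊕ i ⊕ j ≼ z
⊕⊕-≼ {x = x} {z} {i} {j} i≢j xi≼z xj≼z k with i ≟F k | j ≟F k | xi≼z k | xj≼z k
... | yes refl | yes refl | _   | _   = contradiction refl i≢j
... | yes _    | no _     | le  | _   = subst (_≤ z k) (sym (+-identityʳ (x k + 1))) le
... | no _     | _        | _   | le  = subst (λ a → a + _ ≤ z k) (sym (+-identityʳ (x k))) le

-- Count vectors of a colouring

fibre : (Fin n → Fin t) → Fin t → Subset n
fibre col k = tabulate (λ p → does (col p ≟F k))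

∈-fibre⁺ : ∀ {col : Fin n → Fin t} {x k} → col x ≡ k → x ∈ fibre col k
∈-fibre⁺ {col = col} {x} {k} eq = lookup⇒[]= x _ (trans (lookup∘tabulate _ x) (dec-true (col x ≟F k) eq))

∈-fibre⁻ : ∀ {col : Fin n → Fin t} {x k} → x ∈ fibre col k → col x ≡ k
∈-fibre⁻ {col = col} {x} {k} x∈ with col x ≟F k | trans (sym (lookup∘tabulate _ x)) ([]=⇒lookup x∈)
... | yes eq | _ = eq
... | no _   | ()

profile : (Fin n → Fin t) → Subset n → Fin t → ℕ
profile col S k = ∣ S ∩ fibre col k ∣

profile-inside∷ : ∀ (col : Fin (suc n) → Fin t) S → profile col (inside ∷ S) ≗ profile (col ∘ fsuc) S ⊕ col fzero
profile-inside∷ col S k = trans (head-count (does (col fzero ≟F k))) (+-comm (δ (col fzero) k) _)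
  where
    head-count : ∀ b → ∣ b ∷ S ∩ fibre (col ∘ fsuc) k ∣ ≡ (if b then 1 else 0) + profile (col ∘ fsuc) S k
    head-count true  = refl
    head-count false = refl

profile-mono : ∀ (col : Fin n → Fin t) {S T} → S ⊆ T → profile col S ≼ profile col T
profile-mono col {S} {T} S⊆T k = p⊆q⇒∣p∣≤∣q∣ λ x∈ →
  let (x∈S , x∈F) = x∈p∩q⁻ S (fibre col k) x∈ in x∈p∩q⁺ (S⊆T x∈S , x∈F)

profile-∪-⁅⁆ : ∀ (col : Fin n → Fin t) S {x} → x ∉ S → profile col (S ∪ ⁅ x ⁆) ≗ profile col S ⊕ col x
profile-∪-⁅⁆ col (outside ∷ S) {fzero} _ k =
  trans (profile-inside∷ col (S ∪ ⊥) k) (cong (λ U → profile (col ∘ fsuc) U k + δ (col fzero) k) (∪-identityʳ S))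
profile-∪-⁅⁆ col (inside ∷ S) {fzero} x∉ k = contradiction here x∉
profile-∪-⁅⁆ col (outside ∷ S) {fsuc x} x∉ k = profile-∪-⁅⁆ (col ∘ fsuc) S (x∉ ∘ there) k
profile-∪-⁅⁆ col (inside ∷ S) {fsuc x} x∉ k = begin
  profile col (inside ∷ (S ∪ ⁅ x ⁆)) k                             ≡⟨ profile-inside∷ col (S ∪ ⁅ x ⁆) k ⟩
  profile (col ∘ fsuc) (S ∪ ⁅ x ⁆) k + δ (col fzero) k             ≡⟨ cong (_+ δ (col fzero) k) (profile-∪-⁅⁆ (col ∘ fsuc) S (x∉ ∘ there) k) ⟩
  profile (col ∘ fsuc) S k + δ (col (fsuc x)) k + δ (col fzero) k  ≡⟨ CommSemigroup.xy∙z≈xz∙y +-commutativeSemigroup (profile (col ∘ fsuc) S k) _ _ ⟩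
  profile (col ∘ fsuc) S k + δ (col fzero) k + δ (col (fsuc x)) k  ≡⟨ cong (_+ δ (col (fsuc x)) k) (profile-inside∷ col S k) ⟨
  profile col (inside ∷ S) k + δ (col (fsuc x)) k                  ∎
  where open ≡-Reasoning

profile-remove : ∀ (col : Fin n → Fin t) {S x} → x ∈ S → profile col S ≗ profile col (S - x) ⊕ col x
profile-remove col {S} {x} x∈S k = ≤-antisym
  (≤-trans (profile-mono col (⊆-[p-x]∪⁅x⁆ S x) k) (≤-reflexive split))
  (≤-trans (≤-reflexive (sym split)) (profile-mono col (∪⁅⁆-⊆ (p─q⊆p S ⁅ x ⁆) x∈S) k))
  where
    split : profile col ((S - x) ∪ ⁅ x ⁆) k ≡ profile col (S - x) k + δ (col x) k
    split = profile-∪-⁅⁆ col (S - x) (x∉p-x x) k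

profile-nonzero : ∀ (col : Fin n → Fin t) S {k} → 0 < profile col S k → ∃ λ x → x ∈ S × col x ≡ k
profile-nonzero {n} col S {k} pos with nonempty? (S ∩ fibre col k)
... | yes (x , x∈) = let (x∈S , x∈F) = x∈p∩q⁻ S _ x∈ in x , x∈S , ∈-fibre⁻ {col = col} x∈F
... | no empty = contradiction (trans (cong ∣_∣ (Empty-unique empty)) (∣⊥∣≡0 n)) (≢-sym (<⇒≢ pos))

profile-realise : ∀ (col : Fin n → Fin t) A {c : Fin t → ℕ} → c ≼ profile col A →
  ∃ λ S → S ⊆ A × profile col S ≗ c
profile-realise col [] c≼ = [] , (λ ()) , λ k → sym (n≤0⇒n≡0 (c≼ k))
profile-realise col (outside ∷ A) c≼ =
  let (S , S⊆A , S≗c) = profile-realise (col ∘ fsuc) A c≼ in outside ∷ S , out⊆ S⊆A , S≗c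
profile-realise col (inside ∷ A) {c} c≼ with c (col fzero) in c₀≡
... | zero =
  let (S , S⊆A , S≗c) = profile-realise (col ∘ fsuc) A (≼⊕⇒≼ {y = profile (col ∘ fsuc) A} c≼′ (subst (_≤ _) (sym c₀≡) z≤n))
  in outside ∷ S , out⊆ S⊆A , S≗c
  where
    c≼′ : c ≼ profile (col ∘ fsuc) A ⊕ col fzero
    c≼′ = ≼-trans c≼ (≼-reflexive (profile-inside∷ col A))
... | suc _ =
  let (S , S⊆A , S≗c⊖) = profile-realise (col ∘ fsuc) A (⊖-≼ (col fzero) c≼′)
  in inside ∷ S , in⊆in S⊆A , λ k → begin
    profile col (inside ∷ S) k                  ≡⟨ profile-inside∷ col S k ⟩
    profile (col ∘ fsuc) S k + δ (col fzero) k  ≡⟨ cong (_+ δ (col fzero) k) (S≗c⊖ k) ⟩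
    (c ⊖ col fzero ⊕ col fzero) k               ≡⟨ ⊖-⊕ {x = c} (subst (1 ≤_) (sym c₀≡) (s≤s z≤n)) k ⟩
    c k                                         ∎
  where
    open ≡-Reasoning
    c≼′ : c ≼ profile (col ∘ fsuc) A ⊕ col fzero
    c≼′ = ≼-trans c≼ (≼-reflexive (profile-inside∷ col A))

profile-realise-avoiding : ∀ (col : Fin n → Fin t) {x y} → x ≢ y → {c : Fin t → ℕ} →
  c ⊕ col y ⊕ col x ≼ profile col ⊤ → ∃ λ S → x ∉ S × y ∉ S × profile col S ≗ c
profile-realise-avoiding col {x} {y} x≢y {c} c≼ =
  let (S , S⊆A , S≗c) = profile-realise col (⊤ - x - y) c≼A
  in S , x∉p-x x ∘ p─q⊆p (⊤ - x) ⁅ y ⁆ ∘ S⊆A , x∉p-x y ∘ S⊆A , S≗c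
  where
    size : profile col ⊤ ≗ profile col (⊤ - x - y) ⊕ col y ⊕ col x
    size k = trans (profile-remove col ∈⊤ k)
                   (cong (_+ δ (col x) k) (profile-remove col (x∈p∧x≢y⇒x∈p-y ∈⊤ (x≢y ∘ sym)) k))
    c≼A : c ≼ profile col (⊤ - x - y)
    c≼A = ⊕-cancel-≼ (col y) (⊕-cancel-≼ (col x) (≼-trans c≼ (≼-reflexive size)))

-- The classes N_i

interval : ∀ {N} → ℕ → ℕ → Subset N
interval a len = tabulate (λ p → does (a ≤? toℕ p ×-dec toℕ p <? a + len))

does-suc-≤? : ∀ m n → does (suc m ≤? suc n) ≡ does (m ≤? n)
does-suc-≤? m n = does-⇔ (mk⇔ s≤s⁻¹ s≤s) (suc m ≤? suc n) (m ≤? n)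

∣interval∣ : ∀ N a len → a + len ≤ N → ∣ interval {N} a len ∣ ≡ len
∣interval∣ zero    zero    zero      _         = refl
∣interval∣ (suc N) zero    zero      _         = ∣interval∣ N zero zero z≤n
∣interval∣ (suc N) zero    (suc len) (s≤s le) =
  cong suc (trans (cong (∣_∣ {n = N}) (tabulate-cong (λ p → does-suc-≤? (suc (toℕ p)) len))) (∣interval∣ N zero len le))
∣interval∣ (suc N) (suc a) len       (s≤s le) =
  trans (cong (∣_∣ {n = N}) (tabulate-cong (λ p → cong₂ _∧_ (does-suc-≤? a (toℕ p)) (does-suc-≤? (suc (toℕ p)) (a + len)))))
        (∣interval∣ N a len le)

InBlock : (Fin t → ℕ) → Fin t → ℕ → Set
InBlock nb k x = prefix nb k ≤ x × x < prefix nb k + nb k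

inBlock? : ∀ (nb : Fin t → ℕ) k x → Dec (InBlock nb k x)
inBlock? nb k x = prefix nb k ≤? x ×-dec x <? prefix nb k + nb k

inBlock-suc : ∀ (nb : Fin (suc t) → ℕ) k y → InBlock nb (fsuc k) (nb fzero + y) ⇔ InBlock (nb ∘ fsuc) k y
inBlock-suc nb k y = mk⇔
  (λ (P≤ , <P+L) → +-cancelˡ-≤ n₀ _ _ P≤ , +-cancelˡ-< n₀ _ _ (subst (n₀ + y <_) (+-assoc n₀ P L) <P+L))
  (λ (P≤ , <P+L) → +-monoʳ-≤ n₀ P≤ , subst (n₀ + y <_) (sym (+-assoc n₀ P L)) (+-monoʳ-< n₀ <P+L))
  where
    n₀ P L : ℕ
    n₀ = nb fzero
    P = prefix (nb ∘ fsuc) k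
    L = nb (fsuc k)

inBlock-exists : ∀ (nb : Fin t → ℕ) x → x < sumF nb → ∃ λ k → InBlock nb k x
inBlock-exists {suc t} nb x x<Σ with x <? nb fzero
... | yes x<n₀ = fzero , z≤n , x<n₀
... | no x≮n₀ with y , refl ← m≤n⇒∃[o]m+o≡n (≮⇒≥ x≮n₀) =
  let (k , y∈k) = inBlock-exists (nb ∘ fsuc) y (+-cancelˡ-< (nb fzero) _ _ x<Σ)
  in fsuc k , Equivalence.from (inBlock-suc nb k y) y∈k

inBlock-unique : ∀ (nb : Fin t → ℕ) {k k′ x} → InBlock nb k x → InBlock nb k′ x → k ≡ k′
inBlock-unique nb {fzero}  {fzero}    _          _          = refl
inBlock-unique nb {fzero}  {fsuc k′}  (_ , x<n₀) (P′≤x , _) = contradiction (≤-trans (m≤m+n (nb fzero) _) P′≤x) (<⇒≱ x<n₀)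
inBlock-unique nb {fsuc k} {fzero}    (P≤x , _)  (_ , x<n₀) = contradiction (≤-trans (m≤m+n (nb fzero) _) P≤x) (<⇒≱ x<n₀)
inBlock-unique nb {fsuc k} {fsuc k′} x∈k x∈k′
  with y , refl ← m≤n⇒∃[o]m+o≡n (≤-trans (m≤m+n (nb fzero) _) (proj₁ x∈k)) =
  cong fsuc (inBlock-unique (nb ∘ fsuc) (Equivalence.to (inBlock-suc nb k y) x∈k) (Equivalence.to (inBlock-suc nb k′ y) x∈k′))

blockOf : (nb : Fin t → ℕ) → Fin (sumF nb) → Fin t
blockOf nb p = proj₁ (inBlock-exists nb (toℕ p) (toℕ<n p))

inBlock⇔blockOf≡ : ∀ (nb : Fin t → ℕ) p {k} → InBlock nb k (toℕ p) ⇔ blockOf nb p ≡ k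
inBlock⇔blockOf≡ nb p = mk⇔ (inBlock-unique nb p∈) λ { refl → p∈ }
  where
    p∈ : InBlock nb (blockOf nb p) (toℕ p)
    p∈ = proj₂ (inBlock-exists nb (toℕ p) (toℕ<n p))

Block≡fibre : ∀ (nb : Fin t → ℕ) k → Block nb k ≡ fibre (blockOf nb) k
Block≡fibre nb k = tabulate-cong λ p →
  does-⇔ (inBlock⇔blockOf≡ nb p) (inBlock? nb k (toℕ p)) (blockOf nb p ≟F k)

prefix+nb≤sumF : ∀ (nb : Fin t → ℕ) k → prefix nb k + nb k ≤ sumF nb
prefix+nb≤sumF nb fzero    = m≤m+n (nb fzero) _
prefix+nb≤sumF nb (fsuc k) = begin
  nb fzero + prefix (nb ∘ fsuc) k + nb (fsuc k)   ≡⟨ +-assoc (nb fzero) _ _ ⟩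
  nb fzero + (prefix (nb ∘ fsuc) k + nb (fsuc k)) ≤⟨ +-monoʳ-≤ (nb fzero) (prefix+nb≤sumF (nb ∘ fsuc) k) ⟩
  nb fzero + sumF (nb ∘ fsuc)                     ∎
  where open ≤-Reasoning

mvec≗profile : ∀ (nb : Fin t → ℕ) S → mvec nb S ≗ profile (blockOf nb) S
mvec≗profile nb S k = cong (λ B → ∣ S ∩ B ∣) (Block≡fibre nb k)

Block≡interval : ∀ (nb : Fin t → ℕ) k → Block nb k ≡ interval (prefix nb k) (nb k)
Block≡interval nb k = refl

nb≼profile-⊤ : ∀ (nb : Fin t → ℕ) → nb ≼ profile (blockOf nb) ⊤
nb≼profile-⊤ nb k = ≤-reflexive (begin
  nb k                                        ≡⟨ ∣interval∣ (sumF nb) (prefix nb k) (nb k) (prefix+nb≤sumF nb k) ⟨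
  ∣ interval {sumF nb} (prefix nb k) (nb k) ∣ ≡⟨ cong (∣_∣ {n = sumF nb}) (Block≡interval nb k) ⟨
  ∣ Block nb k ∣                              ≡⟨ cong (∣_∣ {n = sumF nb}) (∩-identityˡ (Block nb k)) ⟨
  mvec nb ⊤ k                                 ≡⟨ mvec≗profile nb ⊤ k ⟩
  profile (blockOf nb) ⊤ k                    ∎)
  where open ≡-Reasoning

module _ (nb : Fin t → ℕ) where

  mvec-∪-⁅⁆ : ∀ S {x} → x ∉ S → mvec nb (S ∪ ⁅ x ⁆) ≗ mvec nb S ⊕ blockOf nb x
  mvec-∪-⁅⁆ S {x} x∉S k = begin
    mvec nb (S ∪ ⁅ x ⁆) k                          ≡⟨ mvec≗profile nb (S ∪ ⁅ x ⁆) k ⟩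
    profile (blockOf nb) (S ∪ ⁅ x ⁆) k             ≡⟨ profile-∪-⁅⁆ (blockOf nb) S x∉S k ⟩
    profile (blockOf nb) S k + δ (blockOf nb x) k  ≡⟨ cong (_+ δ (blockOf nb x) k) (mvec≗profile nb S k) ⟨
    mvec nb S k + δ (blockOf nb x) k               ∎
    where open ≡-Reasoning

  mvec-remove : ∀ {S x} → x ∈ S → mvec nb S ≗ mvec nb (S - x) ⊕ blockOf nb x
  mvec-remove {S} {x} x∈S k = begin
    mvec nb S k                                          ≡⟨ mvec≗profile nb S k ⟩
    profile (blockOf nb) S k                             ≡⟨ profile-remove (blockOf nb) x∈S k ⟩
    profile (blockOf nb) (S - x) k + δ (blockOf nb x) k  ≡⟨ cong (_+ δ (blockOf nb x) k) (mvec≗profile nb (S - x) k) ⟨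
    mvec nb (S - x) k + δ (blockOf nb x) k               ∎
    where open ≡-Reasoning

  mvec-mono : ∀ {S T} → S ⊆ T → mvec nb S ≼ mvec nb T
  mvec-mono {S} {T} S⊆T k = subst₂ _≤_ (sym (mvec≗profile nb S k)) (sym (mvec≗profile nb T k))
                                     (profile-mono (blockOf nb) S⊆T k)

  mvec-nonzero : ∀ S {k} → 0 < mvec nb S k → ∃ λ x → x ∈ S × blockOf nb x ≡ k
  mvec-nonzero S {k} pos = profile-nonzero (blockOf nb) S (subst (0 <_) (mvec≗profile nb S k) pos)

  mvec-realise : ∀ {c : Fin t → ℕ} → c ≼ nb → ∃ λ S → mvec nb S ≗ c
  mvec-realise c≼nb =
    let (S , _ , S≗c) = profile-realise (blockOf nb) ⊤ (≼-trans c≼nb (nb≼profile-⊤ nb))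
    in S , λ k → trans (mvec≗profile nb S k) (S≗c k)

  mvec-realise-avoiding : ∀ {x y} → x ≢ y → {c : Fin t → ℕ} → c ⊕ blockOf nb y ⊕ blockOf nb x ≼ nb →
    ∃ λ S → x ∉ S × y ∉ S × mvec nb S ≗ c
  mvec-realise-avoiding x≢y c≼nb =
    let (S , x∉S , y∉S , S≗c) = profile-realise-avoiding (blockOf nb) x≢y
          (≼-trans c≼nb (nb≼profile-⊤ nb))
    in S , x∉S , y∉S , λ k → trans (mvec≗profile nb S k) (S≗c k)

  ∈Block⇔ : ∀ {x k} → x ∈ Block nb k ⇔ blockOf nb x ≡ k
  ∈Block⇔ {x} {k} = mk⇔
    (λ x∈ → ∈-fibre⁻ {col = blockOf nb} (subst (x ∈_) (Block≡fibre nb k) x∈))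
    (λ eq → subst (x ∈_) (sym (Block≡fibre nb k)) (∈-fibre⁺ {col = blockOf nb} eq))

  sameBlock⇔ : ∀ {p q} → SameBlock nb p q ⇔ blockOf nb p ≡ blockOf nb q
  sameBlock⇔ {p} {q} = mk⇔
    (λ (k , p∈k , q∈k) → trans (Equivalence.to (∈Block⇔ {p} {k}) p∈k) (sym (Equivalence.to (∈Block⇔ {q} {k}) q∈k)))
    (λ same → blockOf nb p , Equivalence.from (∈Block⇔ {p}) refl , Equivalence.from (∈Block⇔ {q}) (sym same))

-- Winning vectors

module _ {r} (m : Fin r → Fin t → ℕ) where

  Winningᵛ : (Fin t → ℕ) → Set
  Winningᵛ x = ∃ λ h → m h ≼ x

  winningᵛ-mono : ∀ {x y} → x ≼ y → Winningᵛ x → Winningᵛ y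
  winningᵛ-mono x≼y (h , mh≼x) = h , ≼-trans mh≼x x≼y

  winningᵛ-resp : ∀ {x y} → x ≗ y → Winningᵛ x → Winningᵛ y
  winningᵛ-resp x≗y = winningᵛ-mono (≼-reflexive x≗y)

  IsMinimalWinning : (Fin t → ℕ) → Set
  IsMinimalWinning y = Winningᵛ y × (∀ z → Winningᵛ z → z ≼ y → y ≼ z)

  isMinimalWinning-resp : ∀ {x y} → x ≗ y → IsMinimalWinning x → IsMinimalWinning y
  isMinimalWinning-resp x≗y (win , minimal) =
    winningᵛ-resp x≗y win ,
    λ z wz z≼y → ≼-trans (≼-reflexive (sym ∘ x≗y)) (minimal z wz (≼-trans z≼y (≼-reflexive (sym ∘ x≗y))))

  m-isMinimalWinning : (∀ h h′ → h ≢ h′ → ¬ (m h ≼ m h′)) → ∀ h → IsMinimalWinning (m h)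
  m-isMinimalWinning incomparable h = (h , ≼-refl) , minimal
    where
      minimal : ∀ z → Winningᵛ z → z ≼ m h → m h ≼ z
      minimal z (h′ , mh′≼z) z≼mh with h′ ≟F h
      ... | yes refl = mh′≼z
      ... | no h′≢h  = contradiction (≼-trans mh′≼z z≼mh) (incomparable h′ h h′≢h)

  isMinimalWinning⇒≼m : ∀ {y} → IsMinimalWinning y → ∃ λ h → y ≼ m h
  isMinimalWinning⇒≼m ((h , mh≼y) , minimal) = h , minimal (m h) (h , ≼-refl) mh≼y

  exchange-isMinimalWinning : ∀ {c : Fin t → ℕ} {i j} →
    (∀ d → d ≼ c → Winningᵛ (d ⊕ i) ⇔ Winningᵛ (d ⊕ j)) →
    IsMinimalWinning (c ⊕ j) → IsMinimalWinning (c ⊕ i)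
  exchange-isMinimalWinning {c} {i} {j} exchange (win , minimal) =
    Equivalence.from (exchange c ≼-refl) win , minimal′
    where
      minimal′ : ∀ z → Winningᵛ z → z ≼ c ⊕ i → c ⊕ i ≼ z
      minimal′ z wz z≼ with 1 ≤? z i
      ... | yes 1≤zi =
        let d≼c    = ⊖-≼ i z≼
            wd⊕j   = Equivalence.to (exchange (z ⊖ i) d≼c) (winningᵛ-resp (sym ∘ ⊖-⊕ {x = z} 1≤zi) wz)
            c≼d    = ⊕-cancel-≼ j (minimal (z ⊖ i ⊕ j) wd⊕j (⊕-mono-≼ j d≼c))
        in ≼-trans (⊕-mono-≼ i c≼d) (≼-reflexive (⊖-⊕ {x = z} 1≤zi))
      ... | no 1≰zi =
        let z≼c = ≼⊕⇒≼ {y = c} z≼ (≤-trans (s≤s⁻¹ (≰⇒> 1≰zi)) z≤n)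
        in contradiction (≼-trans (minimal z wz (≼-trans z≼c (≼-⊕ j))) z≼c) (x⊕i⋠x c j)

unit≡δ : ∀ (i k : Fin t) → unit i k ≡ ℤ.+ δ i k
unit≡δ i k with does (i ≟F k)
... | true  = refl
... | false = refl

plusMinus≡⊖ : ∀ (x : Fin t → ℕ) i j k → plusMinus x i j k ≡ (x k + δ i k) ℤ.⊖ δ j k
plusMinus≡⊖ x i j k =
  trans (cong₂ (λ a b → (ℤ.+ x k ℤ.+ a) ℤ.- b) (unit≡δ i k) (unit≡δ j k)) (ℤₚ.[+m]-[+n]≡m⊖n (x k + δ i k) (δ j k))

plusMinus-nonneg⇒1≤ : ∀ (x : Fin t → ℕ) {i j} → i ≢ j → ℤ.+ 0 ℤ.≤ plusMinus x i j j → 1 ≤ x j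
plusMinus-nonneg⇒1≤ x {i} {j} i≢j 0≤ = 1≤ (x j) (subst (ℤ.+ 0 ℤ.≤_) value 0≤)
  where
    value : plusMinus x i j j ≡ (x j + 0) ℤ.⊖ 1
    value = trans (plusMinus≡⊖ x i j j) (cong₂ (λ a b → (x j + a) ℤ.⊖ b) (δ-≢ i≢j) (δ-refl j))
    1≤ : ∀ a → ℤ.+ 0 ℤ.≤ (a + 0) ℤ.⊖ 1 → 1 ≤ a
    1≤ zero    ()
    1≤ (suc a) _  = s≤s z≤n

plusMinus≗⊖⊕ : ∀ (x : Fin t → ℕ) i {j} → 1 ≤ x j → plusMinus x i j ≗ ℤ.+_ ∘ (x ⊖ j ⊕ i)
plusMinus≗⊖⊕ x i {j} 1≤xj k = begin
  plusMinus x i j k              ≡⟨ plusMinus≡⊖ x i j k ⟩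
  (x k + δ i k) ℤ.⊖ δ j k        ≡⟨ ℤₚ.⊖-≥ (≤-trans (δ≤ {x = x} 1≤xj k) (m≤m+n (x k) (δ i k))) ⟩
  ℤ.+ (x k + δ i k ∸ δ j k)      ≡⟨ cong ℤ.+_ (+-∸-comm (δ i k) (δ≤ {x = x} 1≤xj k)) ⟩
  ℤ.+ (x k ∸ δ j k + δ i k)      ∎
  where open ≡-Reasoning

minusPlus≗plusMinus : ∀ (x : Fin t → ℕ) i j → minusPlus x i j ≗ plusMinus x j i
minusPlus≗plusMinus x i j k = CommSemigroup.xy∙z≈xz∙y ℤₚ.+-commutativeSemigroup (ℤ.+ x k) (ℤ.- unit i k) (unit j k)

module _ {r} (nb : Fin t → ℕ) (m : Fin r → Fin t → ℕ) where

  goodShift-resp : ∀ {a b} → a ≗ b → GoodShift nb m a → GoodShift nb m b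
  goodShift-resp a≗b (0≤a , a≤nb , undominated) =
    (λ k → subst (ℤ.+ 0 ℤ.≤_) (a≗b k) (0≤a k)) ,
    (λ k → subst (ℤ._≤ ℤ.+ nb k) (a≗b k) (a≤nb k)) ,
    λ (h , b≤mh) → undominated (h , λ k → subst (ℤ._≤ ℤ.+ m h k) (sym (a≗b k)) (b≤mh k))

  goodShift-plusMinus : ∀ {x : Fin t → ℕ} {i j} → i ≢ j → GoodShift nb m (plusMinus x i j) →
    1 ≤ x j × x ⊖ j ⊕ i ≼ nb × ¬ (∃ λ h → x ⊖ j ⊕ i ≼ m h)
  goodShift-plusMinus {x} {i} {j} i≢j (0≤ , ≤nb , undominated) =
    1≤xj ,
    (λ k → ℤₚ.drop‿+≤+ (subst (ℤ._≤ ℤ.+ nb k) (value k) (≤nb k))) ,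
    λ (h , ≼mh) → undominated (h , λ k → subst (ℤ._≤ ℤ.+ m h k) (sym (value k)) (ℤ.+≤+ (≼mh k)))
    where
      1≤xj : 1 ≤ x j
      1≤xj = plusMinus-nonneg⇒1≤ x i≢j (0≤ j)
      value : plusMinus x i j ≗ ℤ.+_ ∘ (x ⊖ j ⊕ i)
      value = plusMinus≗⊖⊕ x i 1≤xj

-- The game

module _ {r} (nb : Fin t → ℕ) (m : Fin r → Fin t → ℕ)
         (incomparable : ∀ h h′ → h ≢ h′ → ¬ (m h ≼ m h′)) (bounded : ∀ h → m h ≼ nb) where

  private
    W = Winning nb m

  sameBlock⇒equivalent : ∀ {p q} → blockOf nb p ≡ blockOf nb q → Equivalent W p q
  sameBlock⇒equivalent {p} {q} same S p∉S q∉S = mk⇔ (winningᵛ-resp m S∪p≗S∪q) (winningᵛ-resp m (sym ∘ S∪p≗S∪q))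
    where
      S∪p≗S∪q : mvec nb (S ∪ ⁅ p ⁆) ≗ mvec nb (S ∪ ⁅ q ⁆)
      S∪p≗S∪q k = trans (mvec-∪-⁅⁆ nb S p∉S k)
                        (trans (cong (λ b → mvec nb S k + δ b k) same) (sym (mvec-∪-⁅⁆ nb S q∉S k)))

  equivalent⇒exchange : ∀ {p q} → Equivalent W p q → p ≢ q → ∀ {d} →
    d ⊕ blockOf nb q ⊕ blockOf nb p ≼ nb →
    Winningᵛ m (d ⊕ blockOf nb p) ⇔ Winningᵛ m (d ⊕ blockOf nb q)
  equivalent⇒exchange {p} {q} equivalent p≢q {d} d≼ with mvec-realise-avoiding nb p≢q d≼
  ... | S , p∉S , q∉S , S≗d =
    mk⇔ (winningᵛ-resp m S∪q≗d⊕q ∘ Equivalence.to S∪p⇔S∪q ∘ winningᵛ-resp m (sym ∘ S∪p≗d⊕p))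
        (winningᵛ-resp m S∪p≗d⊕p ∘ Equivalence.from S∪p⇔S∪q ∘ winningᵛ-resp m (sym ∘ S∪q≗d⊕q))
    where
      S∪p⇔S∪q : W (S ∪ ⁅ p ⁆) ⇔ W (S ∪ ⁅ q ⁆)
      S∪p⇔S∪q = equivalent S p∉S q∉S
      S∪p≗d⊕p : mvec nb (S ∪ ⁅ p ⁆) ≗ d ⊕ blockOf nb p
      S∪p≗d⊕p k = trans (mvec-∪-⁅⁆ nb S p∉S k) (cong (_+ δ (blockOf nb p) k) (S≗d k))
      S∪q≗d⊕q : mvec nb (S ∪ ⁅ q ⁆) ≗ d ⊕ blockOf nb q
      S∪q≗d⊕q k = trans (mvec-∪-⁅⁆ nb S q∉S k) (cong (_+ δ (blockOf nb q) k) (S≗d k))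

  equivalent⇒¬goodShift : ∀ {p q} → Equivalent W p q → blockOf nb p ≢ blockOf nb q → ∀ h →
    ¬ GoodShift nb m (plusMinus (m h) (blockOf nb p) (blockOf nb q))
  equivalent⇒¬goodShift {p} {q} equivalent i≢j h shift
    with 1≤mhj , c⊕i≼nb , undominated ← goodShift-plusMinus nb m i≢j shift =
    undominated (isMinimalWinning⇒≼m m (exchange-isMinimalWinning m {c} {i} {j} exchange c⊕j-minimal))
    where
      i j : Fin t
      i = blockOf nb p
      j = blockOf nb q
      c : Fin t → ℕ
      c = m h ⊖ j
      c⊕j≗mh : c ⊕ j ≗ m h
      c⊕j≗mh = ⊖-⊕ {x = m h} 1≤mhj
      c⊕j-minimal : IsMinimalWinning m (c ⊕ j)
      c⊕j-minimal = isMinimalWinning-resp m (sym ∘ c⊕j≗mh) (m-isMinimalWinning m incomparable h)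
      exchange : ∀ d → d ≼ c → Winningᵛ m (d ⊕ i) ⇔ Winningᵛ m (d ⊕ j)
      exchange d d≼c = equivalent⇒exchange equivalent (i≢j ∘ cong (blockOf nb))
        (≼-trans (⊕-mono-≼ i (⊕-mono-≼ j d≼c))
                 (⊕⊕-≼ {i = j} {j = i} (i≢j ∘ sym) (≼-trans (≼-reflexive c⊕j≗mh) (bounded h)) c⊕i≼nb))

  equivalent⇒sameBlock :
    (∀ i j → i ≢ j → ∃ λ h → GoodShift nb m (plusMinus (m h) i j) ⊎ GoodShift nb m (minusPlus (m h) i j)) →
    ∀ {p q} → Equivalent W p q → blockOf nb p ≡ blockOf nb q
  equivalent⇒sameBlock shifts {p} {q} equivalent with blockOf nb p ≟F blockOf nb q
  ... | yes same = same
  ... | no i≢j with shifts (blockOf nb p) (blockOf nb q) i≢j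
  ...   | h , inj₁ shift = contradiction shift (equivalent⇒¬goodShift equivalent i≢j h)
  ...   | h , inj₂ shift = contradiction
                             (goodShift-resp nb m (minusPlus≗plusMinus (m h) (blockOf nb p) (blockOf nb q)) shift)
                             (equivalent⇒¬goodShift (equivalent-sym {W = W} equivalent) (i≢j ∘ sym) h)

  equivalent⇔sameBlock :
    (∀ i j → i ≢ j → ∃ λ h → GoodShift nb m (plusMinus (m h) i j) ⊎ GoodShift nb m (minusPlus (m h) i j)) →
    ∀ p q → Equivalent W p q ⇔ SameBlock nb p q
  equivalent⇔sameBlock shifts p q =
    mk⇔ (Equivalence.from (sameBlock⇔ nb) ∘ equivalent⇒sameBlock shifts) (sameBlock⇒equivalent ∘ Equivalence.to (sameBlock⇔ nb))

  minimalWinning⇒m : ∀ {S} → MinimalWinning W S → ∃ λ h → m h ≗ mvec nb S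
  minimalWinning⇒m {S} ((h , mh≼S) , minimal) = h , λ k → ≤-antisym (mh≼S k) (≮⇒≥ (not-below k))
    where
      not-below : ∀ k → ¬ (m h k < mvec nb S k)
      not-below k mhk<Sk with mvec-nonzero nb S {k} (≤-trans (s≤s z≤n) mhk<Sk)
      ... | p , p∈S , refl = minimal (S - p) (x∈p⇒p-x⊂p p∈S) (h , ≼⊕⇒≼ mh≼S-p⊕k mhk≤S-pk)
        where
          mh≼S-p⊕k : m h ≼ mvec nb (S - p) ⊕ blockOf nb p
          mh≼S-p⊕k = ≼-trans mh≼S (≼-reflexive (mvec-remove nb p∈S))
          mhk≤S-pk : m h (blockOf nb p) ≤ mvec nb (S - p) (blockOf nb p)
          mhk≤S-pk = s≤s⁻¹ (subst (m h (blockOf nb p) <_)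
            (trans (mvec-remove nb p∈S (blockOf nb p)) (⊕-diag (mvec nb (S - p)) (blockOf nb p))) mhk<Sk)

  m⇒minimalWinning : ∀ h → ∃ λ S → MinimalWinning W S × mvec nb S ≗ m h
  m⇒minimalWinning h with S , S≗mh ← mvec-realise nb (bounded h) =
    S , ((h , ≼-reflexive (sym ∘ S≗mh)) , minimal) , S≗mh
    where
      mh-minimal : ∀ z → Winningᵛ m z → z ≼ m h → m h ≼ z
      mh-minimal = proj₂ (m-isMinimalWinning m incomparable h)
      minimal : ∀ T → T ⊂ S → ¬ W T
      minimal T (T⊆S , p , p∈S , p∉T) WT =
        x⊕i⋠x (mvec nb T) (blockOf nb p) (≼-trans T⊕p≼mh (mh-minimal (mvec nb T) WT (≼-trans (≼-⊕ (blockOf nb p)) T⊕p≼mh)))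
        where
          T⊕p≼mh : mvec nb T ⊕ blockOf nb p ≼ m h
          T⊕p≼mh = ≼-trans (≼-reflexive (sym ∘ mvec-∪-⁅⁆ nb T p∉T))
                            (≼-trans (mvec-mono nb (∪⁅⁆-⊆ T⊆S p∈S)) (≼-reflexive S≗mh))

  minimalWinning⇔ : ∀ x → (∃ λ S → MinimalWinning W S × mvec nb S ≗ x) ⇔ (∃ λ h → m h ≗ x)
  minimalWinning⇔ x = mk⇔
    (λ (S , minimal , S≗x) → let (h , mh≗S) = minimalWinning⇒m minimal in h , λ k → trans (mh≗S k) (S≗x k))
    (λ (h , mh≗x) → let (S , minimal , S≗mh) = m⇒minimalWinning h in S , minimal , λ k → trans (S≗mh k) (mh≗x k))

mainTheorem3 : (t : ℕ) (nb : Fin t → ℕ) → (∀ i → 0 < nb i) →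
    (r : ℕ) (m : Fin r → Fin t → ℕ) →
    (∀ h h' → h ≢ h' → ¬ (m h ≼ m h')) →
    (∀ h → m h ≼ nb) →
    (∀ i j → i ≢ j → ∃ λ h →
        GoodShift nb m (plusMinus (m h) i j) ⊎ GoodShift nb m (minusPlus (m h) i j)) →
    (∀ (p q : Fin (sumF nb)) → Equivalent (Winning nb m) p q ⇔ SameBlock nb p q)
    × (∀ (x : Fin t → ℕ) → (∃ λ (S : Subset (sumF nb)) → MinimalWinning (Winning nb m) S × (∀ k → mvec nb S k ≡ x k))
             ⇔ (∃ λ h → ∀ k → m h k ≡ x k))
mainTheorem3 t nb _ r m incomparable bounded shifts =
  equivalent⇔sameBlock nb m incomparable bounded shifts , minimalWinning⇔ nb m incomparable bounded
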